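{- Let $G=(V,E)$ be an undirected graph, $w:E\to\mathbb{R}$ arbitrary, and $T\subseteq V$ with $|T|$ even. Let $F$ be a $T$-join of minimum $w$-weight, and suppose $|F|$ is even. Then an edge set $F_{\rm odd}\subseteq E$ is a minimum $w$-weight odd $T$-join if and only if $F_{\rm odd}=F\,\Delta\, C$ for some odd $\emptyset$-join $C$ that has minimum $w[F]$-weight among all odd $\emptyset$-joins.
   Context: For $T\subseteq V$, a $T$-join is a set $J\subseteq E$ such that every vertex of $T$ has odd degree in $J$ and every vertex of $V\setminus T$ has even degree in $J$. An edge set is odd if it has an odd number of edges. For $X\subseteq E$, $w(X)=\sum_{e\in X}w(e)$. For $F\subseteq E$, $w[F]:E\to\mathbb{R}$ is defined by $w[F](e)=-w(e)$ for $e\in F$ and $w[F](e)=w(e)$ for $e\in E\setminus F$. $\Delta$ denotes symmetric difference. -}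

module Defs where

open import Level using (Level; _⊔_) renaming (suc to lsuc)
open import Data.Nat as ℕ using (ℕ; zero; suc; _%_)
open import Data.Fin using (Fin; _≟_)
open import Data.Fin.Subset using (Subset; _∈_; _∉_; ∣_∣; _∪_; _─_; ⊥)
open import Data.Vec using (lookup)
open import Data.Bool using (Bool; true; false; if_then_else_)
open import Data.Product using (_×_; Σ; _,_)
open import Data.Sum using (_⊎_)
open import Relation.Nullary using (does)
open import Relation.Binary.PropositionalEquality using (_≡_)

-- The paper uses real weights; agda-stdlib has no reals, so we
-- let weights range over an arbitrary totally ordered abelian group
-- ((ℝ, 0, +, -, ≤) is an instance).

record OrderedAbelianGroup (c ℓ : Level) : Set (lsuc (c ⊔ ℓ)) where
  infixl 6 _+_
  infix  4 _≤_
  field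
    Carrier     : Set c
    0#          : Carrier
    _+_         : Carrier → Carrier → Carrier
    -_          : Carrier → Carrier
    _≤_         : Carrier → Carrier → Set ℓ
    +-assoc     : ∀ x y z → (x + y) + z ≡ x + (y + z)
    +-comm      : ∀ x y → x + y ≡ y + x
    +-identityˡ : ∀ x → 0# + x ≡ x
    -‿inverseˡ  : ∀ x → (- x) + x ≡ 0#
    ≤-refl      : ∀ x → x ≤ x
    ≤-trans     : ∀ {x y z} → x ≤ y → y ≤ z → x ≤ z
    ≤-antisym   : ∀ {x y} → x ≤ y → y ≤ x → x ≡ y
    ≤-total     : ∀ x y → x ≤ y ⊎ y ≤ x
    +-monoˡ-≤   : ∀ {x y} z → x ≤ y → x + z ≤ y + z

-- Finite undirected (multi)graphs: vertices Fin n, edges Fin m, each edge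
-- e has endpoints end₁ e and end₂ e (a loop has end₁ e ≡ end₂ e and
-- contributes 2 to the degree of its vertex).

record Graph : Set where
  field
    n    : ℕ
    m    : ℕ
    end₁ : Fin m → Fin n
    end₂ : Fin m → Fin n

sumℕ : ∀ {k} → (Fin k → ℕ) → ℕ
sumℕ {zero}  f = 0
sumℕ {suc k} f = f Data.Fin.zero ℕ.+ sumℕ (λ i → f (Data.Fin.suc i))

Even : ℕ → Set
Even k = k % 2 ≡ 0

Odd : ℕ → Set
Odd k = k % 2 ≡ 1

_Δ_ : ∀ {k} → Subset k → Subset k → Subset k
X Δ Y = (X ─ Y) ∪ (Y ─ X)

module _ (G : Graph) where
  open Graph G

  deg : Subset m → Fin n → ℕ
  deg J v = sumℕ λ e →
    if lookup J e
      then (if does (end₁ e ≟ v) then 1 else 0) ℕ.+ (if does (end₂ e ≟ v) then 1 else 0)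
      else 0

  IsJoin : Subset n → Subset m → Set
  IsJoin T J = ∀ v → (v ∈ T → Odd (deg J v)) × (v ∉ T → Even (deg J v))

  OddSet : Subset m → Set
  OddSet J = Odd ∣ J ∣

module _ {c ℓ} (A : OrderedAbelianGroup c ℓ) where
  open OrderedAbelianGroup A

  sumA : ∀ {k} → (Fin k → Carrier) → Carrier
  sumA {zero}  f = 0#
  sumA {suc k} f = f Data.Fin.zero + sumA (λ i → f (Data.Fin.suc i))

  weight : ∀ {m} → (Fin m → Carrier) → Subset m → Carrier
  weight w X = sumA λ e → if lookup X e then w e else 0#

  flipOn : ∀ {m} → (Fin m → Carrier) → Subset m → (Fin m → Carrier)
  flipOn w F e = if lookup F e then - (w e) else w e

  module _ (G : Graph) where
    open Graph G

    IsMinJoin : (Fin m → Carrier) → Subset n → Subset m → Set ℓ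
    IsMinJoin w T J = IsJoin G T J × (∀ J' → IsJoin G T J' → weight w J ≤ weight w J')

    IsMinOddJoin : (Fin m → Carrier) → Subset n → Subset m → Set ℓ
    IsMinOddJoin w T J =
      (IsJoin G T J × OddSet G J) ×
      (∀ J' → IsJoin G T J' → OddSet G J' → weight w J ≤ weight w J')

{-# OPTIONS --safe #-}
-- Fix a T-join F with |F| even.  Since degree parities and cardinality
-- parities add under symmetric difference, the involution X ↦ F Δ X maps the
-- odd T-joins onto the odd ∅-joins and back.  It also shifts weights by a
-- constant, w(F Δ X) = w(F) + w[F](X), so it maps w-minimisers onto
-- w[F]-minimisers.
module Submission where

open import Defs
open import Algebra.Consequences.Propositional
  using (comm∧assoc⇒middleFour; comm∧idˡ⇒idʳ; comm∧invˡ⇒invʳ)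
open import Data.Bool using (true; false; if_then_else_; _∧_; _xor_)
open import Data.Fin using (Fin; zero; suc; _≟_)
open import Data.Fin.Subset using (Subset; ∣_∣; ⊥; _∩_)
open import Data.Fin.Subset.Properties using (_∈?_; ∉⊥)
open import Data.Nat as ℕ using (ℕ; _%_)
import Data.Nat.Properties as ℕ
open import Data.Nat.DivMod using (%-distribˡ-+; [m+kn]%n≡m%n)
open import Data.Product using (Σ; _×_; _,_; proj₁; proj₂; uncurry)
open import Data.Vec using ([]; _∷_; lookup)
open import Data.Vec.Properties using (lookup-zipWith)
open import Function.Base using (_∘_)
open import Function.Bundles using (_⇔_; mk⇔; Equivalence)
open import Relation.Nullary using (does; yes; no; contradiction)
open import Relation.Binary.PropositionalEquality
  using (_≡_; refl; sym; trans; cong; cong₂; subst; subst₂; module ≡-Reasoning)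

lookup-Δ : ∀ {k} (X Y : Subset k) e → lookup (X Δ Y) e ≡ lookup X e xor lookup Y e
lookup-Δ (true  ∷ X) (true  ∷ Y) zero    = refl
lookup-Δ (true  ∷ X) (false ∷ Y) zero    = refl
lookup-Δ (false ∷ X) (true  ∷ Y) zero    = refl
lookup-Δ (false ∷ X) (false ∷ Y) zero    = refl
lookup-Δ (_     ∷ X) (_     ∷ Y) (suc e) = lookup-Δ X Y e

Δ-cancelˡ : ∀ {k} (F X : Subset k) → F Δ (F Δ X) ≡ X
Δ-cancelˡ []          []          = refl
Δ-cancelˡ (true  ∷ F) (true  ∷ X) = cong (true  ∷_) (Δ-cancelˡ F X)
Δ-cancelˡ (true  ∷ F) (false ∷ X) = cong (false ∷_) (Δ-cancelˡ F X)
Δ-cancelˡ (false ∷ F) (true  ∷ X) = cong (true  ∷_) (Δ-cancelˡ F X)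
Δ-cancelˡ (false ∷ F) (false ∷ X) = cong (false ∷_) (Δ-cancelˡ F X)

weightℕ : ∀ {k} → (Fin k → ℕ) → Subset k → ℕ
weightℕ a X = sumℕ λ e → if lookup X e then a e else 0

sumℕ-cong : ∀ {k} {f g : Fin k → ℕ} → (∀ i → f i ≡ g i) → sumℕ f ≡ sumℕ g
sumℕ-cong {ℕ.zero}  f≗g = refl
sumℕ-cong {ℕ.suc k} f≗g = cong₂ ℕ._+_ (f≗g zero) (sumℕ-cong (f≗g ∘ suc))

sumℕ-+ : ∀ {k} (f g : Fin k → ℕ) → sumℕ (λ i → f i ℕ.+ g i) ≡ sumℕ f ℕ.+ sumℕ g
sumℕ-+ {ℕ.zero}  f g = refl
sumℕ-+ {ℕ.suc k} f g =
  trans (cong (f zero ℕ.+ g zero ℕ.+_) (sumℕ-+ (f ∘ suc) (g ∘ suc)))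
        (comm∧assoc⇒middleFour ℕ.+-comm ℕ.+-assoc (f zero) (g zero) (sumℕ (f ∘ suc)) (sumℕ (g ∘ suc)))

∣p∣≡weightℕ : ∀ {k} (p : Subset k) → ∣ p ∣ ≡ weightℕ (λ _ → 1) p
∣p∣≡weightℕ []          = refl
∣p∣≡weightℕ (true  ∷ p) = cong ℕ.suc (∣p∣≡weightℕ p)
∣p∣≡weightℕ (false ∷ p) = ∣p∣≡weightℕ p

weightℕ-Δ : ∀ {k} (a : Fin k → ℕ) (X Y : Subset k) →
  weightℕ a (X Δ Y) ℕ.+ (weightℕ a (X ∩ Y) ℕ.+ weightℕ a (X ∩ Y)) ≡ weightℕ a X ℕ.+ weightℕ a Y
weightℕ-Δ a X Y = begin
  S (X Δ Y) ℕ.+ (S (X ∩ Y) ℕ.+ S (X ∩ Y))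
    ≡⟨ cong (S (X Δ Y) ℕ.+_) (sym (sumℕ-+ (a ↾ (X ∩ Y)) (a ↾ (X ∩ Y)))) ⟩
  S (X Δ Y) ℕ.+ sumℕ (λ e → (a ↾ (X ∩ Y)) e ℕ.+ (a ↾ (X ∩ Y)) e)
    ≡⟨ sym (sumℕ-+ (a ↾ (X Δ Y)) _) ⟩
  sumℕ (λ e → (a ↾ (X Δ Y)) e ℕ.+ ((a ↾ (X ∩ Y)) e ℕ.+ (a ↾ (X ∩ Y)) e))
    ≡⟨ sumℕ-cong pointwise ⟩
  sumℕ (λ e → (a ↾ X) e ℕ.+ (a ↾ Y) e)
    ≡⟨ sumℕ-+ (a ↾ X) (a ↾ Y) ⟩
  S X ℕ.+ S Y ∎
  where
  open ≡-Reasoning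
  _↾_ : (Fin _ → ℕ) → Subset _ → Fin _ → ℕ
  (a ↾ Z) e = if lookup Z e then a e else 0
  S : Subset _ → ℕ
  S = weightℕ a
  split : ∀ x y (n : ℕ) →
    (if x xor y then n else 0) ℕ.+ ((if x ∧ y then n else 0) ℕ.+ (if x ∧ y then n else 0))
      ≡ (if x then n else 0) ℕ.+ (if y then n else 0)
  split true  true  n = refl
  split true  false n = refl
  split false true  n = ℕ.+-identityʳ n
  split false false n = refl
  pointwise : ∀ e → (a ↾ (X Δ Y)) e ℕ.+ ((a ↾ (X ∩ Y)) e ℕ.+ (a ↾ (X ∩ Y)) e) ≡ (a ↾ X) e ℕ.+ (a ↾ Y) e
  pointwise e rewrite lookup-Δ X Y e | lookup-zipWith _∧_ e X Y = split (lookup X e) (lookup Y e) (a e)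

weightℕ-Δ-parity : ∀ {k} (a : Fin k → ℕ) (X Y : Subset k) {p q} →
  weightℕ a X % 2 ≡ p → weightℕ a Y % 2 ≡ q → weightℕ a (X Δ Y) % 2 ≡ (p ℕ.+ q) % 2
weightℕ-Δ-parity a X Y refl refl = begin
  S (X Δ Y) % 2                          ≡⟨ sym ([m+kn]%n≡m%n (S (X Δ Y)) h 2) ⟩
  (S (X Δ Y) ℕ.+ h ℕ.* 2) % 2            ≡⟨ cong (λ z → (S (X Δ Y) ℕ.+ z) % 2) (ℕ.*-comm h 2) ⟩
  (S (X Δ Y) ℕ.+ 2 ℕ.* h) % 2            ≡⟨ cong (λ z → (S (X Δ Y) ℕ.+ (h ℕ.+ z)) % 2) (ℕ.+-identityʳ h) ⟩
  (S (X Δ Y) ℕ.+ (h ℕ.+ h)) % 2          ≡⟨ cong (_% 2) (weightℕ-Δ a X Y) ⟩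
  (S X ℕ.+ S Y) % 2                      ≡⟨ %-distribˡ-+ (S X) (S Y) 2 ⟩
  (S X % 2 ℕ.+ S Y % 2) % 2              ∎
  where
  open ≡-Reasoning
  S = weightℕ a
  h = weightℕ a (X ∩ Y)

even-Δ-odd : ∀ {k} (X Y : Subset k) → Even ∣ X ∣ → Odd ∣ Y ∣ → Odd ∣ X Δ Y ∣
even-Δ-odd X Y even odd
  rewrite ∣p∣≡weightℕ X | ∣p∣≡weightℕ Y | ∣p∣≡weightℕ (X Δ Y) =
  weightℕ-Δ-parity (λ _ → 1) X Y even odd

module _ (G : Graph) where
  open Graph G

  incidence : Fin n → Fin m → ℕ
  incidence v e = (if does (end₁ e ≟ v) then 1 else 0) ℕ.+ (if does (end₂ e ≟ v) then 1 else 0)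

  deg-Δ-parity : ∀ J K v {p q} → deg G J v % 2 ≡ p → deg G K v % 2 ≡ q →
                 deg G (J Δ K) v % 2 ≡ (p ℕ.+ q) % 2
  deg-Δ-parity J K v = weightℕ-Δ-parity (incidence v) J K

  join-Δ-join : ∀ {T} J K → IsJoin G T J → IsJoin G T K → IsJoin G ⊥ (J Δ K)
  join-Δ-join {T} J K J-join K-join v = (λ v∈⊥ → contradiction v∈⊥ ∉⊥) , λ _ → even
    where
    even : Even (deg G (J Δ K) v)
    even with v ∈? T
    ... | yes v∈T = deg-Δ-parity J K v (proj₁ (J-join v) v∈T) (proj₁ (K-join v) v∈T)
    ... | no  v∉T = deg-Δ-parity J K v (proj₂ (J-join v) v∉T) (proj₂ (K-join v) v∉T)

  join-Δ-∅-join : ∀ {T} J C → IsJoin G T J → IsJoin G ⊥ C → IsJoin G T (J Δ C)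
  join-Δ-∅-join J C J-join C-join v =
    (λ v∈T → deg-Δ-parity J C v (proj₁ (J-join v) v∈T) C-even) ,
    (λ v∉T → deg-Δ-parity J C v (proj₂ (J-join v) v∉T) C-even)
    where
    C-even : Even (deg G C v)
    C-even = proj₂ (C-join v) ∉⊥

  module _ {T} (F : Subset m) (F-join : IsJoin G T F) (F-even : Even ∣ F ∣) where

    oddJoin⇒Δ-odd∅-join : ∀ J → IsJoin G T J × OddSet G J → IsJoin G ⊥ (F Δ J) × OddSet G (F Δ J)
    oddJoin⇒Δ-odd∅-join J (J-join , J-odd) = join-Δ-join F J F-join J-join , even-Δ-odd F J F-even J-odd

    odd∅-join⇒Δ-oddJoin : ∀ C → IsJoin G ⊥ C × OddSet G C → IsJoin G T (F Δ C) × OddSet G (F Δ C)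
    odd∅-join⇒Δ-oddJoin C (C-join , C-odd) = join-Δ-∅-join F C F-join C-join , even-Δ-odd F C F-even C-odd

module _ {c ℓ} (A : OrderedAbelianGroup c ℓ) where
  open OrderedAbelianGroup A

  +-identityʳ : ∀ x → x + 0# ≡ x
  +-identityʳ = comm∧idˡ⇒idʳ +-comm +-identityˡ

  -‿inverseʳ : ∀ x → x + (- x) ≡ 0#
  -‿inverseʳ = comm∧invˡ⇒invʳ +-comm -‿inverseˡ

  sumA-cong : ∀ {k} {f g : Fin k → Carrier} → (∀ i → f i ≡ g i) → sumA A f ≡ sumA A g
  sumA-cong {ℕ.zero}  f≗g = refl
  sumA-cong {ℕ.suc k} f≗g = cong₂ _+_ (f≗g zero) (sumA-cong (f≗g ∘ suc))

  sumA-+ : ∀ {k} (f g : Fin k → Carrier) → sumA A (λ i → f i + g i) ≡ sumA A f + sumA A g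
  sumA-+ {ℕ.zero}  f g = sym (+-identityˡ 0#)
  sumA-+ {ℕ.suc k} f g =
    trans (cong (f zero + g zero +_) (sumA-+ (f ∘ suc) (g ∘ suc)))
          (comm∧assoc⇒middleFour +-comm +-assoc (f zero) (g zero) (sumA A (f ∘ suc)) (sumA A (g ∘ suc)))

  weight-Δ : ∀ {k} (w : Fin k → Carrier) (F X : Subset k) →
             weight A w (F Δ X) ≡ weight A w F + weight A (flipOn A w F) X
  weight-Δ w F X =
    trans (sumA-cong pointwise)
          (sumA-+ (λ e → if lookup F e then w e else 0#) (λ e → if lookup X e then flipOn A w F e else 0#))
    where
    split : ∀ x y (a : Carrier) →
      (if x xor y then a else 0#) ≡ (if x then a else 0#) + (if y then (if x then - a else a) else 0#)
    split true  true  a = sym (-‿inverseʳ a)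
    split true  false a = sym (+-identityʳ a)
    split false true  a = sym (+-identityˡ a)
    split false false a = sym (+-identityˡ 0#)
    pointwise : ∀ e → (if lookup (F Δ X) e then w e else 0#)
                    ≡ (if lookup F e then w e else 0#) + (if lookup X e then flipOn A w F e else 0#)
    pointwise e rewrite lookup-Δ F X e = split (lookup F e) (lookup X e) (w e)

  +-monoʳ-≤ : ∀ a {x y} → x ≤ y → a + x ≤ a + y
  +-monoʳ-≤ a {x} {y} x≤y = subst₂ _≤_ (+-comm x a) (+-comm y a) (+-monoˡ-≤ a x≤y)

  +-cancelˡ-≤ : ∀ a {x y} → a + x ≤ a + y → x ≤ y
  +-cancelˡ-≤ a {x} {y} a+x≤a+y = subst₂ _≤_ (-a+[a+z]≡z x) (-a+[a+z]≡z y) (+-monoʳ-≤ (- a) a+x≤a+y)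
    where
    -a+[a+z]≡z : ∀ z → - a + (a + z) ≡ z
    -a+[a+z]≡z z = begin
      - a + (a + z) ≡⟨ sym (+-assoc (- a) a z) ⟩
      - a + a + z   ≡⟨ cong (_+ z) (-‿inverseˡ a) ⟩
      0# + z        ≡⟨ +-identityˡ z ⟩
      z             ∎
      where open ≡-Reasoning

  weight-Δ-≤ : ∀ {k} (w : Fin k → Carrier) (F X Y : Subset k) →
    weight A w (F Δ X) ≤ weight A w (F Δ Y) ⇔ weight A (flipOn A w F) X ≤ weight A (flipOn A w F) Y
  weight-Δ-≤ w F X Y = mk⇔
    (λ ≤ → +-cancelˡ-≤ (weight A w F) (subst₂ _≤_ (weight-Δ w F X) (weight-Δ w F Y) ≤))
    (λ ≤ → subst₂ _≤_ (sym (weight-Δ w F X)) (sym (weight-Δ w F Y)) (+-monoʳ-≤ (weight A w F) ≤))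

proposition6 : ∀ {c ℓ} (A : OrderedAbelianGroup c ℓ) (G : Graph)
    (w : Fin (Graph.m G) → OrderedAbelianGroup.Carrier A)
    (T : Subset (Graph.n G)) → Even ∣ T ∣ →
    (F : Subset (Graph.m G)) → IsMinJoin A G w T F → Even ∣ F ∣ →
    (Fodd : Subset (Graph.m G)) →
    IsMinOddJoin A G w T Fodd ⇔
      Σ (Subset (Graph.m G)) (λ C → (Fodd ≡ F Δ C) × IsMinOddJoin A G (flipOn A w F) ⊥ C)
proposition6 A G w T _ F (F-join , _) F-even Fodd = mk⇔ to from
  where
  open OrderedAbelianGroup A using (_≤_)
  to : IsMinOddJoin A G w T Fodd →
       Σ (Subset (Graph.m G)) (λ C → (Fodd ≡ F Δ C) × IsMinOddJoin A G (flipOn A w F) ⊥ C)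
  to (Fodd-oddJoin , Fodd-min) =
    F Δ Fodd , sym (Δ-cancelˡ F Fodd) , oddJoin⇒Δ-odd∅-join G F F-join F-even Fodd Fodd-oddJoin ,
    λ C C-join C-odd → Equivalence.to (weight-Δ-≤ A w F (F Δ Fodd) C)
      (subst (λ X → weight A w X ≤ weight A w (F Δ C)) (sym (Δ-cancelˡ F Fodd))
        (uncurry (Fodd-min (F Δ C)) (odd∅-join⇒Δ-oddJoin G F F-join F-even C (C-join , C-odd))))
  from : Σ (Subset (Graph.m G)) (λ C → (Fodd ≡ F Δ C) × IsMinOddJoin A G (flipOn A w F) ⊥ C) →
         IsMinOddJoin A G w T Fodd
  from (C , refl , C-oddJoin , C-min) =
    odd∅-join⇒Δ-oddJoin G F F-join F-even C C-oddJoin ,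
    λ J J-join J-odd → subst (λ X → weight A w (F Δ C) ≤ weight A w X) (Δ-cancelˡ F J)
      (Equivalence.from (weight-Δ-≤ A w F C (F Δ J))
        (uncurry (C-min (F Δ J)) (oddJoin⇒Δ-odd∅-join G F F-join F-even J (J-join , J-odd))))
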